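{- Let $r\geq 5$ and let $W_{r+1}=C_r\vee K_1$ be the wheel. Then $\operatorname{ZIR}(W_{r+1})=r-\gamma(C_r)=r-\lceil r/3\rceil$ and $\operatorname{zir}(W_{r+1})=\operatorname{Z}(W_{r+1})=\overline{\operatorname{Z}}(W_{r+1})=3$.
   Context: $C_r\vee K_1$ is the cycle $C_r$ with an extra vertex adjacent to all cycle vertices. $\gamma$ is the domination number. Zero forcing: from a set $B$ of blue vertices, a blue vertex $u$ may turn a white vertex $w$ blue if $w$ is the only white neighbor of $u$; $B$ is a zero forcing set if eventually all vertices are blue. $\operatorname{Z}(G)$ is the minimum size of a zero forcing set; $\overline{\operatorname{Z}}(G)$ is the maximum size of an inclusion-minimal zero forcing set. A fort is a nonempty $F\subseteq V(G)$ such that every $v\notin F$ has $|F\cap N(v)|\neq 1$. For $S\subseteq V(G)$, $x\in S$, a private fort of $x$ relative to $S$ is a fort $F$ with $S\cap F=\{x\}$; $S$ is a ZIr-set if every element has a private fort. $\operatorname{zir}(G)$ and $\operatorname{ZIR}(G)$ are the minimum and maximum cardinality of an inclusion-maximal ZIr-set of $G$. -}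

module Defs where

open import Data.Nat using (ℕ; zero; suc; _+_; _≤_; _≡ᵇ_)
open import Data.Nat.DivMod using (_/_)
open import Data.Bool using (Bool; true; false; _∨_; _∧_; T)
open import Data.Fin using (Fin; toℕ; zero; suc)
open import Data.Fin.Subset using (Subset; _∈_; _∉_; _⊂_; _∩_; ∣_∣; ⁅_⁆; Nonempty; ⊤)
open import Data.Vec using (tabulate; _[_]≔_)
open import Data.Product using (Σ; _×_; ∃)
open import Data.Sum using (_⊎_)
open import Relation.Nullary using (¬_)
open import Relation.Binary.PropositionalEquality using (_≡_; _≢_)

Graph : ℕ → Set
Graph n = Fin n → Fin n → Bool

Adj : ∀ {n} → Graph n → Fin n → Fin n → Set
Adj G u v = T (G u v)

N : ∀ {n} → Graph n → Fin n → Subset n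
N G v = tabulate (G v)

cycle : (r : ℕ) → Graph r
cycle r i j =
  (suc (toℕ i) ≡ᵇ toℕ j) ∨ (suc (toℕ j) ≡ᵇ toℕ i)
  ∨ ((toℕ i ≡ᵇ 0) ∧ (suc (toℕ j) ≡ᵇ r))
  ∨ ((toℕ j ≡ᵇ 0) ∧ (suc (toℕ i) ≡ᵇ r))

-- The wheel W_{r+1} = C_r ∨ K_1: vertex zero is the hub, suc i is cycle vertex i.
wheel : (r : ℕ) → Graph (suc r)
wheel r zero    zero    = false
wheel r zero    (suc j) = true
wheel r (suc i) zero    = true
wheel r (suc i) (suc j) = cycle r i j

Dominating : ∀ {n} → Graph n → Subset n → Set
Dominating G D = ∀ v → v ∈ D ⊎ Σ _ (λ u → u ∈ D × Adj G u v)

IsFort : ∀ {n} → Graph n → Subset n → Set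
IsFort G F = Nonempty F × (∀ v → v ∉ F → ∣ F ∩ N G v ∣ ≢ 1)

PrivateFort : ∀ {n} → Graph n → Subset n → Fin n → Subset n → Set
PrivateFort G S x F = IsFort G F × (S ∩ F ≡ ⁅ x ⁆)

ZIrSet : ∀ {n} → Graph n → Subset n → Set
ZIrSet G S = ∀ x → x ∈ S → ∃ (PrivateFort G S x)

MaximalZIrSet : ∀ {n} → Graph n → Subset n → Set
MaximalZIrSet G S = ZIrSet G S × (∀ S′ → S ⊂ S′ → ¬ ZIrSet G S′)

data Forces {n} (G : Graph n) : Subset n → Set where
  done : ∀ {B} → (∀ v → v ∈ B) → Forces G B
  step : ∀ {B} (u w : Fin n) → u ∈ B → w ∉ B → Adj G u w →
         (∀ x → Adj G u x → x ≢ w → x ∈ B) →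
         Forces G (B [ w ]≔ true) → Forces G B

ZeroForcingSet : ∀ {n} → Graph n → Subset n → Set
ZeroForcingSet G B = Forces G B

MinimalZeroForcingSet : ∀ {n} → Graph n → Subset n → Set
MinimalZeroForcingSet G B = ZeroForcingSet G B × (∀ B′ → B′ ⊂ B → ¬ ZeroForcingSet G B′)

IsMinCard : ∀ {n} → (Subset n → Set) → ℕ → Set
IsMinCard P k = Σ _ (λ S → P S × ∣ S ∣ ≡ k) × (∀ S → P S → k ≤ ∣ S ∣)

IsMaxCard : ∀ {n} → (Subset n → Set) → ℕ → Set
IsMaxCard P k = Σ _ (λ S → P S × ∣ S ∣ ≡ k) × (∀ S → P S → ∣ S ∣ ≤ k)

⌈_/3⌉ : ℕ → ℕ
⌈ r /3⌉ = (r + 2) / 3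

module Submission where

-- Zero forcing sets are exactly the sets meeting every fort.  The forts of the wheel split
-- by the hub: those containing it are {hub} ∪ D with D a dominating set of the rim C_r, those
-- avoiding it are the vertex covers of the rim.  Hence B forces the wheel iff its rim part
-- contains an edge and, when B misses the hub, a closed neighbourhood N[j] = {j-1, j, j+1};
-- this gives Z = Zbar = 3, attained by the hub together with an edge.
--
-- In a ZIr-set S with rim part R, the private fort of a rim vertex x is either a vertex cover
-- K with R ∩ K = {x}, or {hub} ∪ D with D dominating and R ∩ D = {x}, which requires the hub
-- to be outside S.  If the hub is in S, a vertex x of R off an edge inside R would give a
-- cover missing that edge, so R is independent or has at most two vertices.  If not, a closed
-- neighbourhood inside R and a vertex x of R outside it rule out the second kind of fort,
-- since D meets N[j]; so either R lies in the independent set ∁K plus one vertex, or R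
-- contains no closed neighbourhood and the rim outside S dominates C_r.  As γ(C_r) = ⌈r/3⌉,
-- every case gives |S| ≤ r - ⌈r/3⌉ once r ≥ 5, and the complement of every third rim vertex
-- attains it.  The hub with an edge is a maximal ZIr-set, and every ZIr-set with fewer than
-- three vertices can be enlarged, so zir = 3.

open import Data.Bool using (Bool; true; false; T; _∧_; if_then_else_)
open import Data.Bool.Properties using (T?; T-≡; T-∨; T-∧)
open import Data.Empty using (⊥-elim)
open import Data.Fin using (Fin; zero; suc; toℕ; fromℕ; inject₁)
open import Data.Fin.Induction using (<-weakInduction; <-weakInduction-startingFrom)
open import Data.Fin.Permutation using (permutation)
open import Data.Fin.Properties
  using (any?; all?; _≟_; toℕ-injective; toℕ<n; toℕ-fromℕ; toℕ-inject₁; ≤fromℕ)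
import Data.Fin.Properties as Finₚ
open import Data.Fin.Relation.Unary.Top using (view; ‵fromℕ; ‵inject₁; view-fromℕ; view-inject₁)
open import Data.Fin.Subset
open import Data.Fin.Subset.Induction using (⊃-wellFounded; Acc; acc)
open import Data.Fin.Subset.Properties
open import Data.Nat using (ℕ; zero; suc; _+_; _*_; _∸_; _≤_; _<_; s≤s; z≤n; _≡ᵇ_)
open import Data.Nat.DivMod using (m/n≡1+[m∸n]/n; m<n*o⇒m/o<n; m/n*n≤m)
open import Data.Nat.Properties
  using ( +-0-commutativeMonoid; ≤-trans; ≤-reflexive; ≤-antisym; ≤-pred; _≤?_; ≰⇒>; <⇒≱; <⇒≢
        ; n≤1+n; n<1+n; 1+n≢n; 1+n≰n; 0≢1+n; suc-injective; ≡ᵇ⇒≡; ≡⇒≡ᵇ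
        ; +-comm; *-comm; +-suc; +-identityʳ; m≤m+n; +-mono-≤; +-monoˡ-≤; +-monoʳ-≤; +-monoʳ-<
        ; *-monoʳ-≤; +-cancelˡ-≤; m+n≤o⇒m≤o∸n; m∸[m∸n]≡n; ∸-monoʳ-≤; module ≤-Reasoning )
open import Data.Nat.Tactic.RingSolver using (solve-∀)
open import Algebra.Properties.CommutativeMonoid.Sum +-0-commutativeMonoid
  using (sum; sum-cong-≗; sum-permute)
open import Data.Product using (∃; ∃₂; _×_; _,_; proj₁)
import Data.Product as Product
open import Data.Sum using (_⊎_; inj₁; inj₂)
import Data.Sum as Sum
open import Data.Vec using (_∷_; []; _[_]≔_; tabulate; lookup; here; there)
open import Data.Vec.Properties
  using ([]=⇒lookup; lookup⇒[]=; lookup∘tabulate; []≔-updates; []≔-minimal; []=-injective)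
open import Function using (_∘_; _⇔_; mk⇔; Equivalence)
open Equivalence using (to; from)
open import Relation.Nullary using (¬_; Dec; yes; no; contradiction)
open import Relation.Nullary.Decidable using (_×-dec_; _→-dec_; ¬?)
open import Relation.Binary.PropositionalEquality
  using (_≡_; _≢_; refl; sym; trans; cong; cong₂; subst; module ≡-Reasoning)

open import Defs

private
  variable
    n : ℕ
    b : Bool
    p q : Subset n
    x y z : Fin n

-- Finite subsets

∣p∪q∣+∣p∩q∣≡∣p∣+∣q∣ : ∀ (p q : Subset n) → ∣ p ∪ q ∣ + ∣ p ∩ q ∣ ≡ ∣ p ∣ + ∣ q ∣
∣p∪q∣+∣p∩q∣≡∣p∣+∣q∣ []          []          = refl
∣p∪q∣+∣p∩q∣≡∣p∣+∣q∣ (true  ∷ p) (true  ∷ q) = cong suc (begin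
  ∣ p ∪ q ∣ + suc ∣ p ∩ q ∣   ≡⟨ +-suc _ _ ⟩
  suc (∣ p ∪ q ∣ + ∣ p ∩ q ∣) ≡⟨ cong suc (∣p∪q∣+∣p∩q∣≡∣p∣+∣q∣ p q) ⟩
  suc (∣ p ∣ + ∣ q ∣)         ≡⟨ +-suc _ _ ⟨
  ∣ p ∣ + suc ∣ q ∣           ∎)
  where open ≡-Reasoning
∣p∪q∣+∣p∩q∣≡∣p∣+∣q∣ (true  ∷ p) (false ∷ q) = cong suc (∣p∪q∣+∣p∩q∣≡∣p∣+∣q∣ p q)
∣p∪q∣+∣p∩q∣≡∣p∣+∣q∣ (false ∷ p) (true  ∷ q) =
  trans (cong suc (∣p∪q∣+∣p∩q∣≡∣p∣+∣q∣ p q)) (sym (+-suc _ _))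
∣p∪q∣+∣p∩q∣≡∣p∣+∣q∣ (false ∷ p) (false ∷ q) = ∣p∪q∣+∣p∩q∣≡∣p∣+∣q∣ p q

∣p∪q∣≤∣p∣+∣q∣ : ∀ (p q : Subset n) → ∣ p ∪ q ∣ ≤ ∣ p ∣ + ∣ q ∣
∣p∪q∣≤∣p∣+∣q∣ p q = ≤-trans (m≤m+n _ _) (≤-reflexive (∣p∪q∣+∣p∩q∣≡∣p∣+∣q∣ p q))

Empty[p∩q]⇒∣p∪q∣≡∣p∣+∣q∣ : ∀ (p q : Subset n) → Empty (p ∩ q) → ∣ p ∪ q ∣ ≡ ∣ p ∣ + ∣ q ∣
Empty[p∩q]⇒∣p∪q∣≡∣p∣+∣q∣ {n} p q disjoint = begin
  ∣ p ∪ q ∣             ≡⟨ +-identityʳ _ ⟨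
  ∣ p ∪ q ∣ + 0         ≡⟨ cong (∣ p ∪ q ∣ +_) ∣p∩q∣≡0 ⟨
  ∣ p ∪ q ∣ + ∣ p ∩ q ∣ ≡⟨ ∣p∪q∣+∣p∩q∣≡∣p∣+∣q∣ p q ⟩
  ∣ p ∣ + ∣ q ∣         ∎
  where
  open ≡-Reasoning
  ∣p∩q∣≡0 : ∣ p ∩ q ∣ ≡ 0
  ∣p∩q∣≡0 = trans (cong ∣_∣ (Empty-unique disjoint)) (∣⊥∣≡0 n)

x∈p⇒⁅x⁆⊆p : x ∈ p → ⁅ x ⁆ ⊆ p
x∈p⇒⁅x⁆⊆p {x = x} x∈p y∈⁅x⁆ = subst (_∈ _) (sym (x∈⁅y⁆⇒x≡y x y∈⁅x⁆)) x∈p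

p⊆r∧q⊆r⇒p∪q⊆r : ∀ {r : Subset n} → p ⊆ r → q ⊆ r → p ∪ q ⊆ r
p⊆r∧q⊆r⇒p∪q⊆r {p = p} {q} p⊆r q⊆r x∈p∪q with x∈p∪q⁻ p q x∈p∪q
... | inj₁ x∈p = p⊆r x∈p
... | inj₂ x∈q = q⊆r x∈q

∣⁅x⁆∪p∣≤1+∣p∣ : ∀ x (p : Subset n) → ∣ ⁅ x ⁆ ∪ p ∣ ≤ suc ∣ p ∣
∣⁅x⁆∪p∣≤1+∣p∣ x p = ≤-trans (∣p∪q∣≤∣p∣+∣q∣ ⁅ x ⁆ p) (≤-reflexive (cong (_+ ∣ p ∣) (∣⁅x⁆∣≡1 x)))

x∈p⇒0<∣p∣ : x ∈ p → 0 < ∣ p ∣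
x∈p⇒0<∣p∣ {x = x} x∈p = subst (_≤ _) (∣⁅x⁆∣≡1 x) (p⊆q⇒∣p∣≤∣q∣ (x∈p⇒⁅x⁆⊆p x∈p))

x≢y⇒2≤∣p∣ : x ∈ p → y ∈ p → x ≢ y → 2 ≤ ∣ p ∣
x≢y⇒2≤∣p∣ x∈p y∈p x≢y =
  ≤-trans (s≤s (x∈p⇒0<∣p∣ (x∈p∧x≢y⇒x∈p-y y∈p (x≢y ∘ sym)))) (x∈p⇒∣p-x∣<∣p∣ x∈p)

x≢y≢z⇒3≤∣p∣ : x ∈ p → y ∈ p → z ∈ p → x ≢ y → x ≢ z → y ≢ z → 3 ≤ ∣ p ∣
x≢y≢z⇒3≤∣p∣ x∈p y∈p z∈p x≢y x≢z y≢z = ≤-trans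
  (s≤s (x≢y⇒2≤∣p∣ (x∈p∧x≢y⇒x∈p-y y∈p (x≢y ∘ sym)) (x∈p∧x≢y⇒x∈p-y z∈p (x≢z ∘ sym)) y≢z))
  (x∈p⇒∣p-x∣<∣p∣ x∈p)

∣q∣<∣p∣⇒p⊈q : ∣ q ∣ < ∣ p ∣ → ∃ λ x → x ∈ p × x ∉ q
∣q∣<∣p∣⇒p⊈q {q = q} {p} ∣q∣<∣p∣ with any? (λ x → x ∈? p ×-dec ¬? (x ∈? q))
... | yes witness = witness
... | no  none    = contradiction (p⊆q⇒∣p∣≤∣q∣ p⊆q) (<⇒≱ ∣q∣<∣p∣)
  where
  p⊆q : p ⊆ q
  p⊆q {x} x∈p with x ∈? q
  ... | yes x∈q = x∈q
  ... | no  x∉q = contradiction (x , x∈p , x∉q) none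

p⊆q∧∣p∣<∣q∣⇒p⊂q : p ⊆ q → ∣ p ∣ < ∣ q ∣ → p ⊂ q
p⊆q∧∣p∣<∣q∣⇒p⊂q p⊆q ∣p∣<∣q∣ = p⊆q , ∣q∣<∣p∣⇒p⊈q ∣p∣<∣q∣

0<∣p∣⇒Nonempty : 0 < ∣ p ∣ → Nonempty p
0<∣p∣⇒Nonempty {n} {p} 0<∣p∣ with ∣q∣<∣p∣⇒p⊈q {q = ⊥} {p} (subst (_< ∣ p ∣) (sym (∣⊥∣≡0 n)) 0<∣p∣)
... | x , x∈p , _ = x , x∈p

Empty[p∩∁p] : Empty (p ∩ ∁ p)
Empty[p∩∁p] {p = p} (x , x∈p∩∁p) with x∈p∩q⁻ p (∁ p) x∈p∩∁p
... | x∈p , x∈∁p = x∈∁p⇒x∉p x∈∁p x∈p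

Nonempty[∷∩∷] : ∀ {b′} (p q : Subset n) →
                Nonempty ((b ∷ p) ∩ (b′ ∷ q)) → (b ≡ true × b′ ≡ true) ⊎ Nonempty (p ∩ q)
Nonempty[∷∩∷] {b = b} {b′} p q (zero , zero∈) with x∈p∩q⁻ (b ∷ p) (b′ ∷ q) zero∈
... | here , here = inj₁ (refl , refl)
Nonempty[∷∩∷] p q (suc x , there x∈p∩q) = inj₂ (x , x∈p∩q)

x∉p⇒sucx∉b∷p : x ∉ p → suc x ∉ b ∷ p
x∉p⇒sucx∉b∷p x∉p (there x∈p) = x∉p x∈p

x∈q⇒x∉p─q : x ∈ q → x ∉ p ─ q
x∈q⇒x∉p─q {q = true ∷ _} {p = _ ∷ _} here        ()
x∈q⇒x∉p─q {q = _ ∷ _}    {p = _ ∷ p} (there x∈q) (there x∈p─q) = x∈q⇒x∉p─q {p = p} x∈q x∈p─q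

x∉p-x : ∀ x (p : Subset n) → x ∉ p - x
x∉p-x x p = x∈q⇒x∉p─q {p = p} (x∈⁅x⁆ x)

x∈p⇒x∈p[y]≔true : x ∈ p → x ∈ p [ y ]≔ true
x∈p⇒x∈p[y]≔true {x = x} {p} {y} x∈p with x ≟ y
... | yes refl = []≔-updates p x
... | no  x≢y  = []≔-minimal p x y x≢y x∈p

x∈p[y]≔true⇒x∈p : x ∈ p [ y ]≔ true → x ≢ y → x ∈ p
x∈p[y]≔true⇒x∈p {x = x} {p} {y} x∈p[y]≔true x≢y =
  lookup⇒[]= x p ([]=-injective ([]≔-minimal p x y x≢y (lookup⇒[]= x p refl)) x∈p[y]≔true)

preimage : (Fin n → Fin n) → Subset n → Subset n
preimage f p = tabulate (lookup p ∘ f)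

x∈preimage⁺ : ∀ {f : Fin n → Fin n} → f x ∈ p → x ∈ preimage f p
x∈preimage⁺ {x = x} {p = p} {f} fx∈p =
  lookup⇒[]= x _ (trans (lookup∘tabulate (lookup p ∘ f) x) ([]=⇒lookup fx∈p))

x∈preimage⁻ : ∀ {f : Fin n → Fin n} → x ∈ preimage f p → f x ∈ p
x∈preimage⁻ {x = x} {p = p} {f} x∈f⁻¹p =
  lookup⇒[]= (f x) p (trans (sym (lookup∘tabulate (lookup p ∘ f) x)) ([]=⇒lookup x∈f⁻¹p))

indicator : Bool → ℕ
indicator b = if b then 1 else 0

∣p∣≡sum : ∀ (p : Subset n) → ∣ p ∣ ≡ sum (indicator ∘ lookup p)
∣p∣≡sum []          = refl
∣p∣≡sum (true  ∷ p) = cong suc (∣p∣≡sum p)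
∣p∣≡sum (false ∷ p) = ∣p∣≡sum p

∣preimage∣≡∣p∣ : ∀ {f g : Fin n → Fin n} → (∀ y → f (g y) ≡ y) → (∀ x → g (f x) ≡ x) →
                 ∀ (p : Subset n) → ∣ preimage f p ∣ ≡ ∣ p ∣
∣preimage∣≡∣p∣ {f = f} {g} f∘g≗id g∘f≗id p = begin
  ∣ preimage f p ∣                        ≡⟨ ∣p∣≡sum (preimage f p) ⟩
  sum (indicator ∘ lookup (preimage f p))
    ≡⟨ sum-cong-≗ (cong indicator ∘ lookup∘tabulate (lookup p ∘ f)) ⟩
  sum (indicator ∘ lookup p ∘ f)
    ≡⟨ sum-permute (indicator ∘ lookup p) (permutation f g f∘g≗id g∘f≗id) ⟨
  sum (indicator ∘ lookup p)              ≡⟨ ∣p∣≡sum p ⟨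
  ∣ p ∣                                   ∎
  where open ≡-Reasoning

-- Forts and zero forcing in an arbitrary graph

private
  variable
    G : Graph n
    B B′ D D′ F S : Subset n
    v w : Fin n

Adj⇒∈N : ∀ (G : Graph n) {v w} → Adj G v w → w ∈ N G v
Adj⇒∈N G {v} {w} v~w = lookup⇒[]= w _ (trans (lookup∘tabulate (G v) w) (T-≡ .to v~w))

∈N⇒Adj : ∀ (G : Graph n) {v w} → w ∈ N G v → Adj G v w
∈N⇒Adj G {v} {w} w∈N = T-≡ .from (trans (sym (lookup∘tabulate (G v) w)) ([]=⇒lookup w∈N))

dominating-⊆ : D ⊆ D′ → Dominating G D → Dominating G D′
dominating-⊆ D⊆D′ dom v with dom v
... | inj₁ v∈D             = inj₁ (D⊆D′ v∈D)
... | inj₂ (u , u∈D , u~v) = inj₂ (u , D⊆D′ u∈D , u~v)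

NoLoneNeighbour : Graph n → Subset n → Set
NoLoneNeighbour G F =
  ∀ {v w} → v ∉ F → w ∈ F → Adj G v w → ∃ λ w′ → w′ ∈ F × Adj G v w′ × w′ ≢ w

fort⇒noLoneNeighbour : IsFort G F → NoLoneNeighbour G F
fort⇒noLoneNeighbour {G = G} {F} (_ , notOne) {v} {w} v∉F w∈F v~w
  with any? (λ w′ → w′ ∈? F ×-dec T? (G v w′) ×-dec ¬? (w′ ≟ w))
... | yes second = second
... | no  none   =
  ⊥-elim (notOne v v∉F (≤-antisym ∣F∩Nv∣≤1 (x∈p⇒0<∣p∣ (x∈p∩q⁺ (w∈F , Adj⇒∈N G v~w)))))
  where
  F∩Nv⊆⁅w⁆ : F ∩ N G v ⊆ ⁅ w ⁆
  F∩Nv⊆⁅w⁆ {w′} w′∈F∩Nv with w′ ≟ w | x∈p∩q⁻ F (N G v) w′∈F∩Nv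
  ... | yes refl | _            = x∈⁅x⁆ w
  ... | no  w′≢w | w′∈F , w′∈Nv = contradiction (w′ , w′∈F , ∈N⇒Adj G w′∈Nv , w′≢w) none
  ∣F∩Nv∣≤1 : ∣ F ∩ N G v ∣ ≤ 1
  ∣F∩Nv∣≤1 = ≤-trans (p⊆q⇒∣p∣≤∣q∣ F∩Nv⊆⁅w⁆) (≤-reflexive (∣⁅x⁆∣≡1 w))

noLoneNeighbour⇒fort : Nonempty F → NoLoneNeighbour G F → IsFort G F
noLoneNeighbour⇒fort {F = F} {G = G} nonempty noLone = nonempty , notOne
  where
  notOne : ∀ v → v ∉ F → ∣ F ∩ N G v ∣ ≢ 1
  notOne v v∉F ∣F∩Nv∣≡1 with 0<∣p∣⇒Nonempty (subst (0 <_) (sym ∣F∩Nv∣≡1) (s≤s z≤n))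
  ... | w , w∈F∩Nv with x∈p∩q⁻ F (N G v) w∈F∩Nv
  ... | w∈F , w∈Nv with noLone v∉F w∈F (∈N⇒Adj G w∈Nv)
  ... | w′ , w′∈F , v~w′ , w′≢w = 1+n≰n (subst (2 ≤_) ∣F∩Nv∣≡1
        (x≢y⇒2≤∣p∣ (x∈p∩q⁺ (w′∈F , Adj⇒∈N G v~w′)) w∈F∩Nv w′≢w))

Force : Graph n → Subset n → Set
Force G B = ∃₂ λ u w → u ∈ B × w ∉ B × Adj G u w × (∀ x → Adj G u x → x ≢ w → x ∈ B)

force? : ∀ (G : Graph n) B → Dec (Force G B)
force? G B = any? λ u → any? λ w → u ∈? B ×-dec ¬? (w ∈? B) ×-dec T? (G u w) ×-dec
  all? (λ x → T? (G u x) →-dec ¬? (x ≟ w) →-dec x ∈? B)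

stalled⇒∁-fort : ¬ Force G B → Nonempty (∁ B) → IsFort G (∁ B)
stalled⇒∁-fort {G = G} {B = B} stalled white = noLoneNeighbour⇒fort white noLone
  where
  noLone : NoLoneNeighbour G (∁ B)
  noLone {v} {w} v∉∁B w∈∁B v~w
    with any? (λ w′ → ¬? (w′ ∈? B) ×-dec T? (G v w′) ×-dec ¬? (w′ ≟ w))
  ... | yes (w′ , w′∉B , v~w′ , w′≢w) = w′ , x∉p⇒x∈∁p w′∉B , v~w′ , w′≢w
  ... | no  none = contradiction (v , w , x∉∁p⇒x∈p v∉∁B , x∈∁p⇒x∉p w∈∁B , v~w , othersBlue) stalled
    where
    othersBlue : ∀ x → Adj G v x → x ≢ w → x ∈ B
    othersBlue x v~x x≢w with x ∈? B
    ... | yes x∈B = x∈B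
    ... | no  x∉B = contradiction (x , x∉B , v~x , x≢w) none

MeetsEveryFort : Graph n → Subset n → Set
MeetsEveryFort G B = ∀ F → IsFort G F → Nonempty (B ∩ F)

forces⇒meetsEveryFort : Forces G B → MeetsEveryFort G B
forces⇒meetsEveryFort (done all) F ((x , x∈F) , _) = x , x∈p∩q⁺ (all x , x∈F)
forces⇒meetsEveryFort {B = B} (step u w u∈B w∉B u~w othersBlue rest) F fort =
  pullback (forces⇒meetsEveryFort rest F fort)
  where
  pullback : Nonempty ((B [ w ]≔ true) ∩ F) → Nonempty (B ∩ F)
  pullback (y , y∈B′∩F) with x∈p∩q⁻ _ F y∈B′∩F | y ≟ w
  ... | y∈B′ , y∈F | no  y≢w = y , x∈p∩q⁺ (x∈p[y]≔true⇒x∈p y∈B′ y≢w , y∈F)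
  ... | _    , w∈F | yes refl with u ∈? F
  ...   | yes u∈F = u , x∈p∩q⁺ (u∈B , u∈F)
  ...   | no  u∉F with fort⇒noLoneNeighbour fort u∉F w∈F u~w
  ...     | w′ , w′∈F , u~w′ , w′≢w = w′ , x∈p∩q⁺ (othersBlue w′ u~w′ w′≢w , w′∈F)

meetsEveryFort⇒forces : MeetsEveryFort G B → Forces G B
meetsEveryFort⇒forces {G = G} {B = B} = go (⊃-wellFounded B)
  where
  go : ∀ {B} → Acc _⊃_ B → MeetsEveryFort G B → Forces G B
  go {B} (acc larger) meets with force? G B
  ... | yes (u , w , u∈B , w∉B , u~w , othersBlue) =
    step u w u∈B w∉B u~w othersBlue (go (larger B⊂B′) meets′)
    where
    B⊂B′ : B ⊂ B [ w ]≔ true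
    B⊂B′ = x∈p⇒x∈p[y]≔true , w , []≔-updates B w , w∉B
    meets′ : MeetsEveryFort G (B [ w ]≔ true)
    meets′ F fort with meets F fort
    ... | x , x∈B∩F with x∈p∩q⁻ B F x∈B∩F
    ... | x∈B , x∈F = x , x∈p∩q⁺ (x∈p⇒x∈p[y]≔true x∈B , x∈F)
  ... | no stalled with nonempty? (∁ B)
  ...   | no  noWhite = done (λ v → x∉∁p⇒x∈p (λ v∈∁B → noWhite (v , v∈∁B)))
  ...   | yes white   = ⊥-elim (Empty[p∩∁p] (meets (∁ B) (stalled⇒∁-fort stalled white)))

privateFort : IsFort G F → x ∈ S → x ∈ F → S ∩ F ⊆ ⁅ x ⁆ → PrivateFort G S x F
privateFort fort x∈S x∈F S∩F⊆⁅x⁆ = fort , ⊆-antisym S∩F⊆⁅x⁆ (x∈p⇒⁅x⁆⊆p (x∈p∩q⁺ (x∈S , x∈F)))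

privateFort-unique : PrivateFort G S x F → y ∈ S → y ∈ F → y ≡ x
privateFort-unique {x = x} (_ , S∩F≡⁅x⁆) y∈S y∈F =
  x∈⁅y⁆⇒x≡y x (subst (_ ∈_) S∩F≡⁅x⁆ (x∈p∩q⁺ (y∈S , y∈F)))

module _ {P : Subset n → Set} {k : ℕ} {S₀ : Subset n} where

  minimum⇒minimal : (∀ S → P S → k ≤ ∣ S ∣) → ∣ S₀ ∣ ≡ k → ∀ S → S ⊂ S₀ → ¬ P S
  minimum⇒minimal least ∣S₀∣≡k S S⊂S₀ PS =
    <⇒≱ (p⊂q⇒∣p∣<∣q∣ S⊂S₀) (≤-trans (≤-reflexive ∣S₀∣≡k) (least S PS))

  maximum⇒maximal : (∀ S → P S → ∣ S ∣ ≤ k) → ∣ S₀ ∣ ≡ k → ∀ S → S₀ ⊂ S → ¬ P S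
  maximum⇒maximal greatest ∣S₀∣≡k S S₀⊂S PS =
    <⇒≱ (p⊂q⇒∣p∣<∣q∣ S₀⊂S) (≤-trans (greatest S PS) (≤-reflexive (sym ∣S₀∣≡k)))

minimal⇒∣B∣≤∣B′∣ : ∀ {P : Subset n → Set} →
                   (∀ B′ → B′ ⊂ B → ¬ P B′) → B′ ⊆ B → P B′ → ∣ B ∣ ≤ ∣ B′ ∣
minimal⇒∣B∣≤∣B′∣ {B = B} {B′} minimal B′⊆B PB′ with ∣ B ∣ ≤? ∣ B′ ∣
... | yes ∣B∣≤∣B′∣ = ∣B∣≤∣B′∣
... | no  ∣B∣≰∣B′∣ = ⊥-elim (minimal B′ (p⊆q∧∣p∣<∣q∣⇒p⊂q B′⊆B (≰⇒> ∣B∣≰∣B′∣)) PB′)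

-- Every third vertex, and ⌈ n /3⌉

multipleOf3 : ℕ → Bool
multipleOf3 0                   = true
multipleOf3 1                   = false
multipleOf3 2                   = false
multipleOf3 (suc (suc (suc k))) = multipleOf3 k

near-multipleOf3 : ∀ k → multipleOf3 k ≡ true
                       ⊎ (∃ λ k′ → k ≡ suc k′ × multipleOf3 k′ ≡ true)
                       ⊎ multipleOf3 (suc k) ≡ true
near-multipleOf3 0                   = inj₁ refl
near-multipleOf3 1                   = inj₂ (inj₁ (0 , refl , refl))
near-multipleOf3 2                   = inj₂ (inj₂ refl)
near-multipleOf3 (suc (suc (suc k))) =
  Sum.map₂ (Sum.map₁ (λ (k′ , k≡1+k′ , 3∣k′) → 3 + k′ , cong (3 +_) k≡1+k′ , 3∣k′))
           (near-multipleOf3 k)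

thirds : ∀ n → Subset n
thirds n = tabulate (multipleOf3 ∘ toℕ)

multipleOf3⇒∈thirds : multipleOf3 (toℕ x) ≡ true → x ∈ thirds n
multipleOf3⇒∈thirds {x = x} 3∣x =
  lookup⇒[]= x _ (trans (lookup∘tabulate (multipleOf3 ∘ toℕ) x) 3∣x)

⌈3+n/3⌉≡1+⌈n/3⌉ : ∀ n → ⌈ 3 + n /3⌉ ≡ suc ⌈ n /3⌉
⌈3+n/3⌉≡1+⌈n/3⌉ n = m/n≡1+[m∸n]/n {3 + n + 2} {3} (s≤s (s≤s (s≤s z≤n)))

∣thirds∣≡⌈n/3⌉ : ∀ n → ∣ thirds n ∣ ≡ ⌈ n /3⌉
∣thirds∣≡⌈n/3⌉ 0                   = refl
∣thirds∣≡⌈n/3⌉ 1                   = refl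
∣thirds∣≡⌈n/3⌉ 2                   = refl
∣thirds∣≡⌈n/3⌉ (suc (suc (suc n))) = trans (cong suc (∣thirds∣≡⌈n/3⌉ n)) (sym (⌈3+n/3⌉≡1+⌈n/3⌉ n))

⌈n/3⌉≤d : ∀ {n d} → n ≤ 3 * d → ⌈ n /3⌉ ≤ d
⌈n/3⌉≤d {n} {d} n≤3d = ≤-pred (m<n*o⇒m/o<n (begin-strict
  n + 2     <⟨ +-monoʳ-< n (n<1+n 2) ⟩
  n + 3     ≤⟨ +-monoˡ-≤ 3 n≤3d ⟩
  3 * d + 3 ≡⟨ +-comm (3 * d) 3 ⟩
  3 + 3 * d ≡⟨ cong (3 +_) (*-comm 3 d) ⟩
  suc d * 3 ∎))
  where open ≤-Reasoning

1+k+⌈n/3⌉≤n : ∀ {n k} → 5 ≤ n → 2 * k ≤ n → suc k + ⌈ n /3⌉ ≤ n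
1+k+⌈n/3⌉≤n {n} {k} 5≤n 2k≤n = ≰⇒> λ n≤k+⌈n/3⌉ → <⇒≱ 5≤n (+-cancelˡ-≤ (5 * n) n 4 (begin
  5 * n + n                       ≡⟨ 5n+n≡6n n ⟩
  6 * n                           ≤⟨ *-monoʳ-≤ 6 n≤k+⌈n/3⌉ ⟩
  6 * (k + ⌈ n /3⌉)               ≡⟨ 6[a+b]≡3[2a]+2[3b] k ⌈ n /3⌉ ⟩
  3 * (2 * k) + 2 * (⌈ n /3⌉ * 3) ≤⟨ +-mono-≤ (*-monoʳ-≤ 3 2k≤n) (*-monoʳ-≤ 2 (m/n*n≤m (n + 2) 3)) ⟩
  3 * n + 2 * (n + 2)             ≡⟨ 3n+2[n+2]≡5n+4 n ⟩
  5 * n + 4                       ∎))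
  where
  open ≤-Reasoning
  5n+n≡6n : ∀ n → 5 * n + n ≡ 6 * n
  5n+n≡6n = solve-∀
  6[a+b]≡3[2a]+2[3b] : ∀ a b → 6 * (a + b) ≡ 3 * (2 * a) + 2 * (b * 3)
  6[a+b]≡3[2a]+2[3b] = solve-∀
  3n+2[n+2]≡5n+4 : ∀ n → 3 * n + 2 * (n + 2) ≡ 5 * n + 4
  3n+2[n+2]≡5n+4 = solve-∀

1+k≤n∸⌈n/3⌉ : ∀ {n k} → 5 ≤ n → 2 * k ≤ n → suc k ≤ n ∸ ⌈ n /3⌉
1+k≤n∸⌈n/3⌉ 5≤n 2k≤n = m+n≤o⇒m≤o∸n _ (1+k+⌈n/3⌉≤n 5≤n 2k≤n)

-- The cycle C_r, with r = suc m

T-≡ᵇ∧≡ᵇ : ∀ {a b c d} → T ((a ≡ᵇ b) ∧ (c ≡ᵇ d)) ⇔ (a ≡ b × c ≡ d)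
T-≡ᵇ∧≡ᵇ {a} {b} = mk⇔
  (Product.map (≡ᵇ⇒≡ _ _) (≡ᵇ⇒≡ _ _) ∘ T-∧ .to)
  (λ (a≡b , c≡d) → T-∧ {a ≡ᵇ b} .from (≡⇒≡ᵇ _ _ a≡b , ≡⇒≡ᵇ _ _ c≡d))

module Cycle (m : ℕ) where

  C : Graph (suc m)
  C = cycle (suc m)

  private
    variable
      i j : Fin (suc m)
      k : ℕ
      I K R : Subset (suc m)

  next : Fin (suc m) → Fin (suc m)
  next i with view i
  ... | ‵fromℕ     = zero
  ... | ‵inject₁ j = suc j

  prev : Fin (suc m) → Fin (suc m)
  prev zero    = fromℕ m
  prev (suc j) = inject₁ j

  next-fromℕ : next (fromℕ m) ≡ zero
  next-fromℕ rewrite view-fromℕ m = refl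

  next-inject₁ : ∀ j → next (inject₁ j) ≡ suc j
  next-inject₁ j rewrite view-inject₁ j = refl

  next-prev : ∀ i → next (prev i) ≡ i
  next-prev zero    = next-fromℕ
  next-prev (suc j) = next-inject₁ j

  prev-next : ∀ i → prev (next i) ≡ i
  prev-next i with view i
  ... | ‵fromℕ     = refl
  ... | ‵inject₁ j = refl

  next-injective : next i ≡ next j → i ≡ j
  next-injective {i} {j} next-i≡next-j =
    trans (sym (prev-next i)) (trans (cong prev next-i≡next-j) (prev-next j))

  next-induction : ∀ (P : Fin (suc m) → Set) → P i → (∀ j → P j → P (next j)) → ∀ j → P j
  next-induction {i} P Pi Pj⇒Pnext-j = <-weakInduction P P₀ Pinject₁⇒Psuc
    where
    Pinject₁⇒Psuc : ∀ j → P (inject₁ j) → P (suc j)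
    Pinject₁⇒Psuc j = subst P (next-inject₁ j) ∘ Pj⇒Pnext-j (inject₁ j)
    P₀ : P zero
    P₀ = subst P next-fromℕ (Pj⇒Pnext-j (fromℕ m)
           (<-weakInduction-startingFrom P Pi Pinject₁⇒Psuc (≤fromℕ i)))

  -- The arithmetic content of `cycle`: its four disjuncts say Next i j or Next j i.
  Next : Fin (suc m) → Fin (suc m) → Set
  Next i j = suc (toℕ i) ≡ toℕ j ⊎ (toℕ j ≡ 0 × toℕ i ≡ m)

  Next-next : ∀ i → Next i (next i)
  Next-next i with view i
  ... | ‵fromℕ     = inj₂ (refl , toℕ-fromℕ m)
  ... | ‵inject₁ j = inj₁ (cong suc (toℕ-inject₁ j))

  private
    lastHasNoSuc : suc (toℕ i) ≡ toℕ j → toℕ i ≢ m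
    lastHasNoSuc {j = j} i+1≡j i≡m = <⇒≢ (toℕ<n j) (trans (sym i+1≡j) (cong suc i≡m))

  Next-functional : ∀ {l} → Next i j → Next i l → j ≡ l
  Next-functional (inj₁ i+1≡j)     (inj₁ i+1≡l)     = toℕ-injective (trans (sym i+1≡j) i+1≡l)
  Next-functional (inj₁ i+1≡j)     (inj₂ (_ , i≡m)) = ⊥-elim (lastHasNoSuc i+1≡j i≡m)
  Next-functional (inj₂ (_ , i≡m)) (inj₁ i+1≡l)     = ⊥-elim (lastHasNoSuc i+1≡l i≡m)
  Next-functional (inj₂ (j≡0 , _)) (inj₂ (l≡0 , _)) = toℕ-injective (trans j≡0 (sym l≡0))

  Next⇒≡next : Next i j → j ≡ next i
  Next⇒≡next i→j = Next-functional i→j (Next-next _)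

  ≡next⇒Next : j ≡ next i → Next i j
  ≡next⇒Next refl = Next-next _

  Next-refl⇒m≡0 : Next i i → m ≡ 0
  Next-refl⇒m≡0 (inj₁ i+1≡i)       = ⊥-elim (1+n≢n i+1≡i)
  Next-refl⇒m≡0 (inj₂ (i≡0 , i≡m)) = trans (sym i≡m) i≡0

  Next-sym⇒m≤1 : Next i j → Next j i → m ≤ 1
  Next-sym⇒m≤1 (inj₁ i+1≡j)       (inj₁ j+1≡i)       =
    ⊥-elim (1+n≰n (≤-trans (n≤1+n _) (≤-reflexive (trans (cong suc i+1≡j) j+1≡i))))
  Next-sym⇒m≤1 (inj₁ i+1≡j)       (inj₂ (i≡0 , j≡m)) =
    ≤-reflexive (trans (sym j≡m) (trans (sym i+1≡j) (cong suc i≡0)))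
  Next-sym⇒m≤1 (inj₂ (j≡0 , i≡m)) (inj₁ j+1≡i)       =
    ≤-reflexive (trans (sym i≡m) (trans (sym j+1≡i) (cong suc j≡0)))
  Next-sym⇒m≤1 (inj₂ (_ , i≡m))   (inj₂ (i≡0 , _))   =
    ≤-trans (≤-reflexive (trans (sym i≡m) i≡0)) z≤n

  adj⇒Next⊎Next : ∀ i j → Adj C i j → Next i j ⊎ Next j i
  adj⇒Next⊎Next i j i~j with T-∨ .to i~j
  ... | inj₁ i→j = inj₁ (inj₁ (≡ᵇ⇒≡ _ _ i→j))
  ... | inj₂ rest with T-∨ .to rest
  ... | inj₁ j→i = inj₂ (inj₁ (≡ᵇ⇒≡ _ _ j→i))
  ... | inj₂ rest′ with T-∨ .to rest′
  ... | inj₁ i↺j = inj₂ (inj₂ (T-≡ᵇ∧≡ᵇ .to i↺j))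
  ... | inj₂ j↺i = inj₁ (inj₂ (T-≡ᵇ∧≡ᵇ .to j↺i))

  Next⊎Next⇒adj : ∀ i j → Next i j ⊎ Next j i → Adj C i j
  Next⊎Next⇒adj i j =
    T-∨ {i→j} .from ∘ Sum.map₂ (T-∨ {j→i} .from ∘ Sum.map₂ (T-∨ {i↺j} .from)) ∘ disjuncts
    where
    i→j j→i i↺j j↺i : Bool
    i→j = suc (toℕ i) ≡ᵇ toℕ j
    j→i = suc (toℕ j) ≡ᵇ toℕ i
    i↺j = (toℕ i ≡ᵇ 0) ∧ (toℕ j ≡ᵇ m)
    j↺i = (toℕ j ≡ᵇ 0) ∧ (toℕ i ≡ᵇ m)
    disjuncts : Next i j ⊎ Next j i → T i→j ⊎ T j→i ⊎ T i↺j ⊎ T j↺i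
    disjuncts (inj₁ (inj₁ i+1≡j)) = inj₁ (≡⇒≡ᵇ _ _ i+1≡j)
    disjuncts (inj₂ (inj₁ j+1≡i)) = inj₂ (inj₁ (≡⇒≡ᵇ _ _ j+1≡i))
    disjuncts (inj₂ (inj₂ i↺j))   = inj₂ (inj₂ (inj₁ (T-≡ᵇ∧≡ᵇ .from i↺j)))
    disjuncts (inj₁ (inj₂ j↺i))   = inj₂ (inj₂ (inj₂ (T-≡ᵇ∧≡ᵇ .from j↺i)))

  adj⇔ : ∀ i j → Adj C i j ⇔ (j ≡ next i ⊎ i ≡ next j)
  adj⇔ i j = mk⇔ (Sum.map Next⇒≡next Next⇒≡next ∘ adj⇒Next⊎Next i j)
                 (Next⊎Next⇒adj i j ∘ Sum.map ≡next⇒Next ≡next⇒Next)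

  adj-sym : ∀ i j → Adj C i j → Adj C j i
  adj-sym i j = adj⇔ j i .from ∘ Sum.swap ∘ adj⇔ i j .to

  next~ : ∀ i → Adj C (next i) i
  next~ i = adj⇔ (next i) i .from (inj₂ refl)

  prev~ : ∀ i → Adj C (prev i) i
  prev~ i = adj⇔ (prev i) i .from (inj₁ (sym (next-prev i)))

  ~next : ∀ i → Adj C i (next i)
  ~next i = adj⇔ i (next i) .from (inj₁ refl)

  ~prev : ∀ i → Adj C i (prev i)
  ~prev i = adj⇔ i (prev i) .from (inj₂ (sym (next-prev i)))

  next≢id : 1 ≤ m → next i ≢ i
  next≢id {i} 1≤m next-i≡i =
    <⇒≢ 1≤m (sym (Next-refl⇒m≡0 (subst (Next i) next-i≡i (Next-next i))))

  next²≢id : 2 ≤ m → next (next i) ≢ i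
  next²≢id {i} 2≤m next²-i≡i =
    <⇒≱ 2≤m (Next-sym⇒m≤1 (Next-next i) (subst (Next (next i)) next²-i≡i (Next-next (next i))))

  prev≢id : 1 ≤ m → prev i ≢ i
  prev≢id {i} 1≤m prev-i≡i = next≢id 1≤m (trans (next-prev i) (sym prev-i≡i))

  prev≢next : 2 ≤ m → prev i ≢ next i
  prev≢next {i} 2≤m prev-i≡next-i =
    next²≢id 2≤m (trans (cong next (next-prev i)) (sym prev-i≡next-i))

  toℕ-prev : toℕ i ≡ suc k → toℕ (prev i) ≡ k
  toℕ-prev {i} i≡1+k with ≡next⇒Next (sym (next-prev i))
  ... | inj₁ prev-i+1≡i = suc-injective (trans prev-i+1≡i i≡1+k)
  ... | inj₂ (i≡0 , _)  = ⊥-elim (0≢1+n (trans (sym i≡0) i≡1+k))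

  ∣preimage-next∣ : ∀ (p : Subset (suc m)) → ∣ preimage next p ∣ ≡ ∣ p ∣
  ∣preimage-next∣ = ∣preimage∣≡∣p∣ {f = next} {prev} next-prev prev-next

  ∣preimage-prev∣ : ∀ (p : Subset (suc m)) → ∣ preimage prev p ∣ ≡ ∣ p ∣
  ∣preimage-prev∣ = ∣preimage∣≡∣p∣ {f = prev} {next} prev-next next-prev

  -- Each vertex v has v, next v or prev v in D, and shifting D along the cycle keeps its size.
  dominating⇒r≤3∣D∣ : ∀ {D} → Dominating C D → suc m ≤ 3 * ∣ D ∣
  dominating⇒r≤3∣D∣ {D} dom = begin
    suc m                             ≡⟨ ∣⊤∣≡n (suc m) ⟨
    ∣ ⊤ {suc m} ∣                     ≤⟨ p⊆q⇒∣p∣≤∣q∣ covered ⟩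
    ∣ D ∪ D∘next ∪ D∘prev ∣           ≤⟨ ∣p∪q∣≤∣p∣+∣q∣ D (D∘next ∪ D∘prev) ⟩
    ∣ D ∣ + ∣ D∘next ∪ D∘prev ∣       ≤⟨ +-monoʳ-≤ ∣ D ∣ (∣p∪q∣≤∣p∣+∣q∣ D∘next D∘prev) ⟩
    ∣ D ∣ + (∣ D∘next ∣ + ∣ D∘prev ∣) ≡⟨ cong₂ (λ a b → ∣ D ∣ + (a + b)) (∣preimage-next∣ D) ∣D∘prev∣≡∣D∣+0 ⟩
    3 * ∣ D ∣                         ∎
    where
    open ≤-Reasoning
    D∘next D∘prev : Subset (suc m)
    D∘next = preimage next D
    D∘prev = preimage prev D
    ∣D∘prev∣≡∣D∣+0 : ∣ D∘prev ∣ ≡ ∣ D ∣ + 0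
    ∣D∘prev∣≡∣D∣+0 = trans (∣preimage-prev∣ D) (sym (+-identityʳ _))
    covered : ⊤ ⊆ D ∪ D∘next ∪ D∘prev
    covered {v} _ with dom v
    ... | inj₁ v∈D = x∈p∪q⁺ (inj₁ v∈D)
    ... | inj₂ (u , u∈D , u~v) with adj⇔ u v .to u~v
    ...   | inj₁ v≡next-u =
      x∈p∪q⁺ (inj₂ (x∈p∪q⁺ (inj₂ (x∈preimage⁺ {f = prev} (subst (_∈ D) u≡prev-v u∈D)))))
      where
      u≡prev-v : u ≡ prev v
      u≡prev-v = sym (trans (cong prev v≡next-u) (prev-next u))
    ...   | inj₂ u≡next-v =
      x∈p∪q⁺ (inj₂ (x∈p∪q⁺ (inj₁ (x∈preimage⁺ {f = next} (subst (_∈ D) u≡next-v u∈D)))))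

  dominating⇒⌈r/3⌉≤∣D∣ : ∀ {D} → Dominating C D → ⌈ suc m /3⌉ ≤ ∣ D ∣
  dominating⇒⌈r/3⌉≤∣D∣ = ⌈n/3⌉≤d ∘ dominating⇒r≤3∣D∣

  ∁-dominating⇒∣R∣≤r∸⌈r/3⌉ : Dominating C (∁ R) → ∣ R ∣ ≤ suc m ∸ ⌈ suc m /3⌉
  ∁-dominating⇒∣R∣≤r∸⌈r/3⌉ {R} dom = subst (_≤ suc m ∸ ⌈ suc m /3⌉) (m∸[m∸n]≡n (∣p∣≤n R))
    (∸-monoʳ-≤ (suc m) (subst (⌈ suc m /3⌉ ≤_) (∣∁p∣≡n∸∣p∣ R) (dominating⇒⌈r/3⌉≤∣D∣ dom)))

  thirds-dominating : Dominating C (thirds (suc m))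
  thirds-dominating v with near-multipleOf3 (toℕ v)
  ... | inj₁ 3∣v = inj₁ (multipleOf3⇒∈thirds 3∣v)
  ... | inj₂ (inj₁ (k , v≡1+k , 3∣k)) = inj₂ (prev v , multipleOf3⇒∈thirds 3∣prev-v , prev~ v)
    where
    3∣prev-v : multipleOf3 (toℕ (prev v)) ≡ true
    3∣prev-v = subst (λ t → multipleOf3 t ≡ true) (sym (toℕ-prev v≡1+k)) 3∣k
  ... | inj₂ (inj₂ 3∣v+1) = inj₂ (next v , multipleOf3⇒∈thirds 3∣next-v , next~ v)
    where
    3∣next-v : multipleOf3 (toℕ (next v)) ≡ true
    3∣next-v with Next-next v
    ... | inj₁ v+1≡next-v     = subst (λ t → multipleOf3 t ≡ true) v+1≡next-v 3∣v+1
    ... | inj₂ (next-v≡0 , _) = subst (λ t → multipleOf3 t ≡ true) (sym next-v≡0) refl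

  Independent : Subset (suc m) → Set
  Independent I = ∀ i → i ∈ I → next i ∉ I

  VertexCover : Subset (suc m) → Set
  VertexCover K = ∀ i → i ∈ K ⊎ next i ∈ K

  independent⇒2∣I∣≤r : Independent I → 2 * ∣ I ∣ ≤ suc m
  independent⇒2∣I∣≤r {I} indep = begin
    2 * ∣ I ∣                   ≡⟨ cong (∣ I ∣ +_) (+-identityʳ ∣ I ∣) ⟩
    ∣ I ∣ + ∣ I ∣               ≡⟨ cong (∣ I ∣ +_) (∣preimage-next∣ I) ⟨
    ∣ I ∣ + ∣ preimage next I ∣ ≡⟨ Empty[p∩q]⇒∣p∪q∣≡∣p∣+∣q∣ I (preimage next I) disjoint ⟨
    ∣ I ∪ preimage next I ∣     ≤⟨ ∣p∣≤n (I ∪ preimage next I) ⟩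
    suc m                       ∎
    where
    open ≤-Reasoning
    disjoint : Empty (I ∩ preimage next I)
    disjoint (i , i∈I∩I∘next) with x∈p∩q⁻ I _ i∈I∩I∘next
    ... | i∈I , i∈I∘next = indep i i∈I (x∈preimage⁻ {f = next} i∈I∘next)

  independent⇒∁-cover : Independent I → VertexCover (∁ I)
  independent⇒∁-cover {I} indep i with i ∈? I
  ... | yes i∈I = inj₂ (x∉p⇒x∈∁p (indep i i∈I))
  ... | no  i∉I = inj₁ (x∉p⇒x∈∁p i∉I)

  cover⇒∁-independent : VertexCover K → Independent (∁ K)
  cover⇒∁-independent cover i i∈∁K next-i∈∁K with cover i
  ... | inj₁ i∈K      = x∈∁p⇒x∉p i∈∁K i∈K
  ... | inj₂ next-i∈K = x∈∁p⇒x∉p next-i∈∁K next-i∈K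

  edge : Fin (suc m) → Subset (suc m)
  edge i = ⁅ i ⁆ ∪ ⁅ next i ⁆

  closedNbhd : Fin (suc m) → Subset (suc m)
  closedNbhd j = ⁅ prev j ⁆ ∪ edge j

  i∈edge : ∀ i → i ∈ edge i
  i∈edge i = x∈p∪q⁺ (inj₁ (x∈⁅x⁆ i))

  next∈edge : ∀ i → next i ∈ edge i
  next∈edge i = x∈p∪q⁺ (inj₂ (x∈⁅x⁆ (next i)))

  prev∈closedNbhd : ∀ j → prev j ∈ closedNbhd j
  prev∈closedNbhd j = x∈p∪q⁺ (inj₁ (x∈⁅x⁆ (prev j)))

  edge⊆closedNbhd : ∀ j → edge j ⊆ closedNbhd j
  edge⊆closedNbhd j = q⊆p∪q ⁅ prev j ⁆ (edge j)

  ∣edge∣≡2 : 1 ≤ m → ∀ i → ∣ edge i ∣ ≡ 2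
  ∣edge∣≡2 1≤m i = ≤-antisym
    (≤-trans (∣⁅x⁆∪p∣≤1+∣p∣ i ⁅ next i ⁆) (≤-reflexive (cong suc (∣⁅x⁆∣≡1 (next i)))))
    (x≢y⇒2≤∣p∣ (i∈edge i) (next∈edge i) (next≢id 1≤m ∘ sym))

  ∣closedNbhd∣≡3 : 2 ≤ m → ∀ j → ∣ closedNbhd j ∣ ≡ 3
  ∣closedNbhd∣≡3 2≤m j = ≤-antisym
    (≤-trans (∣⁅x⁆∪p∣≤1+∣p∣ (prev j) (edge j)) (≤-reflexive (cong suc (∣edge∣≡2 1≤m j))))
    (x≢y≢z⇒3≤∣p∣ (prev∈closedNbhd j) (edge⊆closedNbhd j (i∈edge j)) (edge⊆closedNbhd j (next∈edge j))
      (prev≢id 1≤m) (prev≢next 2≤m) (next≢id 1≤m ∘ sym))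
    where
    1≤m : 1 ≤ m
    1≤m = ≤-trans (n≤1+n 1) 2≤m

  edge⊆⇒2≤∣R∣ : 1 ≤ m → edge i ⊆ R → 2 ≤ ∣ R ∣
  edge⊆⇒2≤∣R∣ {i} 1≤m edge⊆R = subst (_≤ _) (∣edge∣≡2 1≤m i) (p⊆q⇒∣p∣≤∣q∣ edge⊆R)

  closedNbhd⊆⇒3≤∣R∣ : 2 ≤ m → closedNbhd j ⊆ R → 3 ≤ ∣ R ∣
  closedNbhd⊆⇒3≤∣R∣ {j} 2≤m N[j]⊆R = subst (_≤ _) (∣closedNbhd∣≡3 2≤m j) (p⊆q⇒∣p∣≤∣q∣ N[j]⊆R)

  edge⊆⊎independent : ∀ R → (∃ λ i → edge i ⊆ R) ⊎ Independent R
  edge⊆⊎independent R with any? (λ i → i ∈? R ×-dec next i ∈? R)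
  ... | yes (i , i∈R , next-i∈R) =
    inj₁ (i , p⊆r∧q⊆r⇒p∪q⊆r (x∈p⇒⁅x⁆⊆p i∈R) (x∈p⇒⁅x⁆⊆p next-i∈R))
  ... | no  noEdge = inj₂ (λ i i∈R next-i∈R → noEdge (i , i∈R , next-i∈R))

  closedNbhd⊆⊎∁-dominating : ∀ R → (∃ λ j → closedNbhd j ⊆ R) ⊎ Dominating C (∁ R)
  closedNbhd⊆⊎∁-dominating R with any? (λ j → prev j ∈? R ×-dec j ∈? R ×-dec next j ∈? R)
  ... | yes (j , prev-j∈R , j∈R , next-j∈R) = inj₁ (j , p⊆r∧q⊆r⇒p∪q⊆r (x∈p⇒⁅x⁆⊆p prev-j∈R)
    (p⊆r∧q⊆r⇒p∪q⊆r (x∈p⇒⁅x⁆⊆p j∈R) (x∈p⇒⁅x⁆⊆p next-j∈R)))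
  ... | no  noClosedNbhd = inj₂ dominated
    where
    dominated : Dominating C (∁ R)
    dominated v with v ∈? R | prev v ∈? R | next v ∈? R
    ... | no  v∉R | _          | _          = inj₁ (x∉p⇒x∈∁p v∉R)
    ... | yes _   | no  prev∉R | _          = inj₂ (prev v , x∉p⇒x∈∁p prev∉R , prev~ v)
    ... | yes _   | yes _      | no  next∉R = inj₂ (next v , x∉p⇒x∈∁p next∉R , next~ v)
    ... | yes v∈R | yes prev∈R | yes next∈R = ⊥-elim (noClosedNbhd (v , prev∈R , v∈R , next∈R))

  ∣I∣≤1⇒independent : 1 ≤ m → ∣ I ∣ ≤ 1 → Independent I
  ∣I∣≤1⇒independent {I} 1≤m ∣I∣≤1 with edge⊆⊎independent I
  ... | inj₁ (_ , edge⊆I) = ⊥-elim (1+n≰n (≤-trans (edge⊆⇒2≤∣R∣ 1≤m edge⊆I) ∣I∣≤1))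
  ... | inj₂ indep        = indep

  ∣R∣≤2⇒∁-dominating : 2 ≤ m → ∣ R ∣ ≤ 2 → Dominating C (∁ R)
  ∣R∣≤2⇒∁-dominating {R} 2≤m ∣R∣≤2 with closedNbhd⊆⊎∁-dominating R
  ... | inj₁ (_ , N[j]⊆R) = ⊥-elim (1+n≰n (≤-trans (closedNbhd⊆⇒3≤∣R∣ 2≤m N[j]⊆R) ∣R∣≤2))
  ... | inj₂ dom          = dom

  cover-meets-edge : VertexCover K → ∀ i → ∃ λ u → u ∈ edge i × u ∈ K
  cover-meets-edge cover i with cover i
  ... | inj₁ i∈K      = i , i∈edge i , i∈K
  ... | inj₂ next-i∈K = next i , next∈edge i , next-i∈K

  dominating-meets-closedNbhd : ∀ {D} → Dominating C D → ∀ j → ∃ λ u → u ∈ closedNbhd j × u ∈ D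
  dominating-meets-closedNbhd dom j with dom j
  ... | inj₁ j∈D = j , edge⊆closedNbhd j (i∈edge j) , j∈D
  ... | inj₂ (u , u∈D , u~j) with adj⇔ u j .to u~j
  ...   | inj₁ j≡next-u = u , subst (_∈ closedNbhd j) prev-j≡u (prev∈closedNbhd j) , u∈D
    where
    prev-j≡u : prev j ≡ u
    prev-j≡u = trans (cong prev j≡next-u) (prev-next u)
  ...   | inj₂ u≡next-j =
    u , subst (_∈ closedNbhd j) (sym u≡next-j) (edge⊆closedNbhd j (next∈edge j)) , u∈D

  cover∩⊆⁅x⁆⇒x∈edge : ∀ {x} → VertexCover K → R ∩ K ⊆ ⁅ x ⁆ → edge i ⊆ R → x ∈ edge i
  cover∩⊆⁅x⁆⇒x∈edge {i = i} {x} cover R∩K⊆⁅x⁆ edge⊆R with cover-meets-edge cover i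
  ... | u , u∈edge , u∈K =
    subst (_∈ edge i) (x∈⁅y⁆⇒x≡y x (R∩K⊆⁅x⁆ (x∈p∩q⁺ (edge⊆R u∈edge , u∈K)))) u∈edge

  dominating∩⊆⁅x⁆⇒x∈closedNbhd : ∀ {D x} → Dominating C D → R ∩ D ⊆ ⁅ x ⁆ →
                                  closedNbhd j ⊆ R → x ∈ closedNbhd j
  dominating∩⊆⁅x⁆⇒x∈closedNbhd {j = j} {x = x} dom R∩D⊆⁅x⁆ N[j]⊆R
    with dominating-meets-closedNbhd dom j
  ... | u , u∈N[j] , u∈D =
    subst (_∈ closedNbhd j) (x∈⁅y⁆⇒x≡y x (R∩D⊆⁅x⁆ (x∈p∩q⁺ (N[j]⊆R u∈N[j] , u∈D)))) u∈N[j]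

-- The wheel W_{r+1}, with r = suc m

module Wheel {m : ℕ} (2≤m : 2 ≤ m) where
  open Cycle m

  W : Graph (suc (suc m))
  W = wheel (suc m)

  private
    variable
      K R : Subset (suc m)

    1≤m : 1 ≤ m
    1≤m = ≤-trans (n≤1+n 1) 2≤m

  hubFort⇒dominating : IsFort W (true ∷ D) → Dominating C D
  hubFort⇒dominating {D} fort v with v ∈? D
  ... | yes v∈D = inj₁ v∈D
  ... | no  v∉D with fort⇒noLoneNeighbour {G = W} fort {suc v} {zero} (x∉p⇒sucx∉b∷p v∉D) here _
  ...   | zero  , _         , _   , 0≢0 = ⊥-elim (0≢0 refl)
  ...   | suc u , there u∈D , v~u , _   = inj₂ (u , u∈D , adj-sym v u v~u)

  dominating⇒hubFort : Dominating C D → IsFort W (true ∷ D)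
  dominating⇒hubFort {D} dom = noLoneNeighbour⇒fort (zero , here) noLone
    where
    noLone : NoLoneNeighbour W (true ∷ D)
    noLone {zero}  zero∉F = ⊥-elim (zero∉F here)
    noLone {suc v} {zero} v∉F _ _ with dom v
    ... | inj₁ v∈D             = ⊥-elim (v∉F (there v∈D))
    ... | inj₂ (u , u∈D , u~v) = suc u , there u∈D , adj-sym u v u~v , λ ()
    noLone {suc v} {suc w} _ _ _ = zero , here , _ , λ ()

  -- If two consecutive rim vertices are missing from a hub-free fort, the fort condition at
  -- the second one pushes the gap one step further, until the fort is empty.
  rimFort⇒cover : IsFort W (false ∷ K) → VertexCover K
  rimFort⇒cover {K} fort i with i ∈? K | next i ∈? K
  ... | yes i∈K | _            = inj₁ i∈K
  ... | no  _   | yes next-i∈K = inj₂ next-i∈K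
  ... | no  i∉K | no  next-i∉K = ⊥-elim (empty (proj₁ fort))
    where
    Gap : Fin (suc m) → Set
    Gap j = j ∉ K × next j ∉ K
    propagate : ∀ j → Gap j → Gap (next j)
    propagate j (j∉K , next-j∉K) = next-j∉K , λ next²-j∈K →
      lone (fort⇒noLoneNeighbour {G = W} fort {suc (next j)}
              (x∉p⇒sucx∉b∷p next-j∉K) (there next²-j∈K) (~next (next j)))
      where
      lone : ¬ ∃ λ w → w ∈ false ∷ K × Adj W (suc (next j)) w × w ≢ suc (next (next j))
      lone (suc u , there u∈K , next-j~u , u≢next²-j) with adj⇔ (next j) u .to next-j~u
      ... | inj₁ u≡next²-j     = u≢next²-j (cong suc u≡next²-j)
      ... | inj₂ next-j≡next-u = j∉K (subst (_∈ K) (next-injective (sym next-j≡next-u)) u∈K)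
    empty : ¬ Nonempty (false ∷ K)
    empty (suc u , there u∈K) = proj₁ (next-induction Gap (i∉K , next-i∉K) propagate u) u∈K

  cover⇒rimFort : VertexCover K → IsFort W (false ∷ K)
  cover⇒rimFort {K} cover = noLoneNeighbour⇒fort nonempty noLone
    where
    nonempty : Nonempty (false ∷ K)
    nonempty with cover-meets-edge cover zero
    ... | u , _ , u∈K = suc u , there u∈K
    noLone : NoLoneNeighbour W (false ∷ K)
    noLone {zero} {suc a} _ _ _ with cover (next a)
    ... | inj₁ next-a∈K  = suc (next a) , there next-a∈K , _ , next≢id 1≤m ∘ Finₚ.suc-injective
    ... | inj₂ next²-a∈K = suc (next (next a)) , there next²-a∈K , _ , next²≢id 2≤m ∘ Finₚ.suc-injective
    noLone {suc v} {suc w} v∉F _ v~w with adj⇔ v w .to v~w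
    ... | inj₁ refl = suc (prev v) , there prev-v∈K , ~prev v , prev≢next 2≤m ∘ Finₚ.suc-injective
      where
      prev-v∈K : prev v ∈ K
      prev-v∈K with cover (prev v)
      ... | inj₁ prev-v∈K = prev-v∈K
      ... | inj₂ v∈K      = ⊥-elim (v∉F (there (subst (_∈ K) (next-prev v) v∈K)))
    ... | inj₂ refl = suc (next v) , there next-v∈K , ~next v , next²≢id 2≤m ∘ Finₚ.suc-injective
      where
      next-v∈K : next v ∈ K
      next-v∈K with cover v
      ... | inj₁ v∈K      = ⊥-elim (v∉F (there v∈K))
      ... | inj₂ next-v∈K = next-v∈K

  forces⇒edge⊆ : Forces W (b ∷ R) → ∃ λ i → edge i ⊆ R
  forces⇒edge⊆ {b = b} {R = R} forces with edge⊆⊎independent R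
  ... | inj₁ edge⊆R = edge⊆R
  ... | inj₂ indep with Nonempty[∷∩∷] {b = b} {false} R (∁ R)
                          (forces⇒meetsEveryFort forces _ (cover⇒rimFort (independent⇒∁-cover indep)))
  ... | inj₁ (_ , ())
  ... | inj₂ R∩∁R≢∅ = ⊥-elim (Empty[p∩∁p] R∩∁R≢∅)

  forces⇒closedNbhd⊆ : Forces W (false ∷ R) → ∃ λ j → closedNbhd j ⊆ R
  forces⇒closedNbhd⊆ {R} forces with closedNbhd⊆⊎∁-dominating R
  ... | inj₁ N[j]⊆R = N[j]⊆R
  ... | inj₂ dom with Nonempty[∷∩∷] {b = false} {true} R (∁ R)
                        (forces⇒meetsEveryFort forces _ (dominating⇒hubFort dom))
  ... | inj₁ (() , _)
  ... | inj₂ R∩∁R≢∅ = ⊥-elim (Empty[p∩∁p] R∩∁R≢∅)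

  edge⊆⇒forces : ∀ {i} → edge i ⊆ R → Forces W (true ∷ R)
  edge⊆⇒forces {R} {i} edge⊆R = meetsEveryFort⇒forces meets
    where
    meets : MeetsEveryFort W (true ∷ R)
    meets (true  ∷ _) _    = zero , here
    meets (false ∷ K) fort with cover-meets-edge (rimFort⇒cover fort) i
    ... | u , u∈edge , u∈K = suc u , there (x∈p∩q⁺ (edge⊆R u∈edge , u∈K))

  closedNbhd⊆⇒forces : ∀ {j} → closedNbhd j ⊆ R → Forces W (b ∷ R)
  closedNbhd⊆⇒forces {R = R} {j = j} N[j]⊆R = meetsEveryFort⇒forces meets
    where
    meets : MeetsEveryFort W (_ ∷ R)
    meets (true  ∷ D) fort with dominating-meets-closedNbhd (hubFort⇒dominating fort) j
    ... | u , u∈N[j] , u∈D = suc u , there (x∈p∩q⁺ (N[j]⊆R u∈N[j] , u∈D))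
    meets (false ∷ K) fort with cover-meets-edge (rimFort⇒cover fort) j
    ... | u , u∈edge , u∈K = suc u , there (x∈p∩q⁺ (N[j]⊆R (edge⊆closedNbhd j u∈edge) , u∈K))

  hubEdge : Subset (suc (suc m))
  hubEdge = true ∷ edge zero

  ∣hubEdge∣≡3 : ∣ hubEdge ∣ ≡ 3
  ∣hubEdge∣≡3 = cong suc (∣edge∣≡2 1≤m zero)

  hubEdge-forces : Forces W hubEdge
  hubEdge-forces = edge⊆⇒forces ⊆-refl

  forces⇒3≤∣B∣ : ∀ B → Forces W B → 3 ≤ ∣ B ∣
  forces⇒3≤∣B∣ (true ∷ R) forces with forces⇒edge⊆ forces
  ... | _ , edge⊆R = s≤s (edge⊆⇒2≤∣R∣ 1≤m edge⊆R)
  forces⇒3≤∣B∣ (false ∷ R) forces with forces⇒closedNbhd⊆ forces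
  ... | _ , N[j]⊆R = closedNbhd⊆⇒3≤∣R∣ 2≤m N[j]⊆R

  minimalForcing⇒∣B∣≤3 : ∀ B → MinimalZeroForcingSet W B → ∣ B ∣ ≤ 3
  minimalForcing⇒∣B∣≤3 (true ∷ R) (forces , minimal) with forces⇒edge⊆ forces
  ... | i , edge⊆R = ≤-trans (minimal⇒∣B∣≤∣B′∣ minimal (s⊆s edge⊆R) (edge⊆⇒forces ⊆-refl))
                             (≤-reflexive (cong suc (∣edge∣≡2 1≤m i)))
  minimalForcing⇒∣B∣≤3 (false ∷ R) (forces , minimal) with forces⇒closedNbhd⊆ forces
  ... | j , N[j]⊆R = ≤-trans (minimal⇒∣B∣≤∣B′∣ minimal (s⊆s N[j]⊆R) (closedNbhd⊆⇒forces ⊆-refl))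
                             (≤-reflexive (∣closedNbhd∣≡3 2≤m j))

  privateFort⇒∩⊆⁅x⁆ : ∀ {b′} → PrivateFort W (b ∷ R) (suc x) (b′ ∷ K) → R ∩ K ⊆ ⁅ x ⁆
  privateFort⇒∩⊆⁅x⁆ {R = R} {x = x} {K = K} pf y∈R∩K with x∈p∩q⁻ R K y∈R∩K
  ... | y∈R , y∈K = subst (_∈ ⁅ x ⁆)
    (sym (Finₚ.suc-injective (privateFort-unique {G = W} {x = suc x} pf (there y∈R) (there y∈K))))
    (x∈⁅x⁆ x)

  hubPrivateFort⇒hub∉S : PrivateFort W (b ∷ R) (suc x) (true ∷ D) → b ≡ false
  hubPrivateFort⇒hub∉S {b = false} _ = refl
  hubPrivateFort⇒hub∉S {b = true} {x = x} pf with privateFort-unique {G = W} {x = suc x} pf here here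
  ... | ()

  rimVertex-privateFort : ZIrSet W (b ∷ R) → x ∈ R →
    (∃ λ K → VertexCover K × R ∩ K ⊆ ⁅ x ⁆) ⊎ (b ≡ false × ∃ λ D → Dominating C D × R ∩ D ⊆ ⁅ x ⁆)
  rimVertex-privateFort {x = x} zir x∈R with zir (suc x) (there x∈R)
  ... | false ∷ K , pf = inj₁ (K , rimFort⇒cover (proj₁ pf) , privateFort⇒∩⊆⁅x⁆ pf)
  ... | true  ∷ D , pf =
    inj₂ (hubPrivateFort⇒hub∉S pf , D , hubFort⇒dominating (proj₁ pf) , privateFort⇒∩⊆⁅x⁆ pf)

  ∣R∣≤2⇒ZIr[true∷R] : ∣ R ∣ ≤ 2 → ZIrSet W (true ∷ R)
  ∣R∣≤2⇒ZIr[true∷R] {R} ∣R∣≤2 zero _ =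
    true ∷ ∁ R ,
    privateFort {G = W} (dominating⇒hubFort (∣R∣≤2⇒∁-dominating 2≤m ∣R∣≤2)) here here onlyHub
    where
    onlyHub : (true ∷ R) ∩ (true ∷ ∁ R) ⊆ ⁅ zero ⁆
    onlyHub here           = here
    onlyHub (there y∈R∩∁R) = ⊥-elim (Empty[p∩∁p] (_ , y∈R∩∁R))
  ∣R∣≤2⇒ZIr[true∷R] {R} ∣R∣≤2 (suc x) (there x∈R) =
    false ∷ ∁ (R - x) ,
    privateFort {G = W} {F = false ∷ ∁ (R - x)} {x = suc x} {S = true ∷ R}
      fort (there x∈R) (there (x∉p⇒x∈∁p (x∉p-x x R))) onlyX
    where
    fort : IsFort W (false ∷ ∁ (R - x))
    fort = cover⇒rimFort (independent⇒∁-cover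
             (∣I∣≤1⇒independent 1≤m (≤-pred (≤-trans (x∈p⇒∣p-x∣<∣p∣ x∈R) ∣R∣≤2))))
    onlyX : (true ∷ R) ∩ (false ∷ ∁ (R - x)) ⊆ ⁅ suc x ⁆
    onlyX {suc y} (there y∈R∩∁[R-x]) with x∈p∩q⁻ R (∁ (R - x)) y∈R∩∁[R-x] | y ≟ x
    ... | _   , _        | yes refl = there (x∈⁅x⁆ x)
    ... | y∈R , y∈∁[R-x] | no  y≢x  = ⊥-elim (x∈∁p⇒x∉p y∈∁[R-x] (x∈p∧x≢y⇒x∈p-y y∈R y≢x))

  hubEdge-ZIr : ZIrSet W hubEdge
  hubEdge-ZIr = ∣R∣≤2⇒ZIr[true∷R] (≤-reflexive (∣edge∣≡2 1≤m zero))

  hubEdge⊂⇒¬ZIr : ∀ S → hubEdge ⊂ S → ¬ ZIrSet W S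
  hubEdge⊂⇒¬ZIr (false ∷ _) (hubEdge⊆S , _) _ with hubEdge⊆S here
  ... | ()
  hubEdge⊂⇒¬ZIr (true ∷ _) (_ , zero , _ , zero∉hubEdge) _ = zero∉hubEdge here
  hubEdge⊂⇒¬ZIr (true ∷ R) (hubEdge⊆S , suc c , there c∈R , c∉hubEdge) zir
    with rimVertex-privateFort zir c∈R
  ... | inj₂ (() , _)
  ... | inj₁ (K , cover , R∩K⊆⁅c⁆) =
    c∉hubEdge (there (cover∩⊆⁅x⁆⇒x∈edge {i = zero} cover R∩K⊆⁅c⁆ (drop-∷-⊆ hubEdge⊆S)))

  maximalZIr⇒3≤∣S∣ : ∀ S → MaximalZIrSet W S → 3 ≤ ∣ S ∣
  maximalZIr⇒3≤∣S∣ (false ∷ R) (_ , maximal) with 3 ≤? ∣ R ∣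
  ... | yes 3≤∣R∣ = 3≤∣R∣
  ... | no  3≰∣R∣ =
    ⊥-elim (maximal (true ∷ R) (out⊂in ⊆-refl) (∣R∣≤2⇒ZIr[true∷R] (≤-pred (≰⇒> 3≰∣R∣))))
  maximalZIr⇒3≤∣S∣ (true ∷ R) (_ , maximal) with 2 ≤? ∣ R ∣
  ... | yes 2≤∣R∣ = s≤s 2≤∣R∣
  ... | no  2≰∣R∣ with ∣q∣<∣p∣⇒p⊈q {q = R} {p = ⊤} ∣R∣<∣⊤∣
    where
    ∣R∣<∣⊤∣ : ∣ R ∣ < ∣ ⊤ {suc m} ∣
    ∣R∣<∣⊤∣ = ≤-trans (≰⇒> 2≰∣R∣) (subst (2 ≤_) (sym (∣⊤∣≡n (suc m))) (s≤s 1≤m))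
  ... | a , _ , a∉R = ⊥-elim (maximal (true ∷ (⁅ a ⁆ ∪ R)) R⊂⁅a⁆∪R (∣R∣≤2⇒ZIr[true∷R] ∣⁅a⁆∪R∣≤2))
    where
    R⊂⁅a⁆∪R : true ∷ R ⊂ true ∷ (⁅ a ⁆ ∪ R)
    R⊂⁅a⁆∪R = in⊂in (q⊆p∪q ⁅ a ⁆ R , a , x∈p∪q⁺ (inj₁ (x∈⁅x⁆ a)) , a∉R)
    ∣⁅a⁆∪R∣≤2 : ∣ ⁅ a ⁆ ∪ R ∣ ≤ 2
    ∣⁅a⁆∪R∣≤2 = ≤-trans (∣⁅x⁆∪p∣≤1+∣p∣ a R) (≰⇒> 2≰∣R∣)

  ZIr[true∷R]⇒2∣R∣≤r : 3 ≤ m → ZIrSet W (true ∷ R) → 2 * ∣ R ∣ ≤ suc m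
  ZIr[true∷R]⇒2∣R∣≤r {R} 3≤m zir with edge⊆⊎independent R | ∣ R ∣ ≤? 2
  ... | inj₂ indep        | _         = independent⇒2∣I∣≤r indep
  ... | inj₁ _            | yes ∣R∣≤2 = ≤-trans (*-monoʳ-≤ 2 ∣R∣≤2) (s≤s 3≤m)
  ... | inj₁ (i , edge⊆R) | no  ∣R∣≰2
    with ∣q∣<∣p∣⇒p⊈q (subst (_< ∣ R ∣) (sym (∣edge∣≡2 1≤m i)) (≰⇒> ∣R∣≰2))
  ... | x , x∈R , x∉edge with rimVertex-privateFort zir x∈R
  ... | inj₂ (() , _)
  ... | inj₁ (K , cover , R∩K⊆⁅x⁆) = ⊥-elim (x∉edge (cover∩⊆⁅x⁆⇒x∈edge cover R∩K⊆⁅x⁆ edge⊆R))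

  ZIr[false∷R]⇒∣R∣≤r∸⌈r/3⌉ : 5 ≤ suc m → ZIrSet W (false ∷ R) → ∣ R ∣ ≤ suc m ∸ ⌈ suc m /3⌉
  ZIr[false∷R]⇒∣R∣≤r∸⌈r/3⌉ {R} 5≤r zir with closedNbhd⊆⊎∁-dominating R | ∣ R ∣ ≤? 3
  ... | inj₂ dom          | _         = ∁-dominating⇒∣R∣≤r∸⌈r/3⌉ dom
  ... | inj₁ _            | yes ∣R∣≤3 = ≤-trans ∣R∣≤3 (1+k≤n∸⌈n/3⌉ 5≤r (≤-trans (n≤1+n 4) 5≤r))
  ... | inj₁ (j , N[j]⊆R) | no  ∣R∣≰3
    with ∣q∣<∣p∣⇒p⊈q (subst (_< ∣ R ∣) (sym (∣closedNbhd∣≡3 2≤m j)) (≰⇒> ∣R∣≰3))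
  ... | x , x∈R , x∉N[j] with rimVertex-privateFort zir x∈R
  ... | inj₂ (_ , D , dom , R∩D⊆⁅x⁆) =
    ⊥-elim (x∉N[j] (dominating∩⊆⁅x⁆⇒x∈closedNbhd dom R∩D⊆⁅x⁆ N[j]⊆R))
  ... | inj₁ (K , cover , R∩K⊆⁅x⁆) = begin
    ∣ R ∣                   ≤⟨ p⊆q⇒∣p∣≤∣q∣ R⊆⁅x⁆∪∁K ⟩
    ∣ ⁅ x ⁆ ∪ ∁ K ∣         ≤⟨ ∣⁅x⁆∪p∣≤1+∣p∣ x (∁ K) ⟩
    suc ∣ ∁ K ∣             ≤⟨ 1+k≤n∸⌈n/3⌉ 5≤r (independent⇒2∣I∣≤r (cover⇒∁-independent cover)) ⟩
    suc m ∸ ⌈ suc m /3⌉     ∎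
    where
    open ≤-Reasoning
    R⊆⁅x⁆∪∁K : R ⊆ ⁅ x ⁆ ∪ ∁ K
    R⊆⁅x⁆∪∁K {y} y∈R with y ∈? K
    ... | yes y∈K = x∈p∪q⁺ (inj₁ (R∩K⊆⁅x⁆ (x∈p∩q⁺ (y∈R , y∈K))))
    ... | no  y∉K = x∈p∪q⁺ (inj₂ (x∉p⇒x∈∁p y∉K))

  ZIr⇒∣S∣≤r∸⌈r/3⌉ : 5 ≤ suc m → ∀ S → ZIrSet W S → ∣ S ∣ ≤ suc m ∸ ⌈ suc m /3⌉
  ZIr⇒∣S∣≤r∸⌈r/3⌉ 5≤r (true  ∷ R) zir =
    1+k≤n∸⌈n/3⌉ 5≤r (ZIr[true∷R]⇒2∣R∣≤r (≤-pred (≤-trans (n≤1+n 4) 5≤r)) zir)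
  ZIr⇒∣S∣≤r∸⌈r/3⌉ 5≤r (false ∷ R) zir = ZIr[false∷R]⇒∣R∣≤r∸⌈r/3⌉ 5≤r zir

  coThirds : Subset (suc (suc m))
  coThirds = false ∷ ∁ (thirds (suc m))

  ∣coThirds∣ : ∣ coThirds ∣ ≡ suc m ∸ ⌈ suc m /3⌉
  ∣coThirds∣ = trans (∣∁p∣≡n∸∣p∣ (thirds (suc m))) (cong (suc m ∸_) (∣thirds∣≡⌈n/3⌉ (suc m)))

  coThirds-ZIr : ZIrSet W coThirds
  coThirds-ZIr (suc x) (there x∉thirds) =
    true ∷ (⁅ x ⁆ ∪ thirds (suc m)) ,
    privateFort {G = W} {F = true ∷ (⁅ x ⁆ ∪ thirds (suc m))} {x = suc x} {S = coThirds}
      (dominating⇒hubFort (dominating-⊆ (q⊆p∪q ⁅ x ⁆ (thirds (suc m))) thirds-dominating))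
      (there x∉thirds) (there (x∈p∪q⁺ (inj₁ (x∈⁅x⁆ x)))) onlyX
    where
    onlyX : coThirds ∩ (true ∷ (⁅ x ⁆ ∪ thirds (suc m))) ⊆ ⁅ suc x ⁆
    onlyX {suc y} (there y∈) with x∈p∩q⁻ (∁ (thirds (suc m))) (⁅ x ⁆ ∪ thirds (suc m)) y∈
    ... | y∉thirds , y∈⁅x⁆∪thirds with x∈p∪q⁻ ⁅ x ⁆ (thirds (suc m)) y∈⁅x⁆∪thirds
    ...   | inj₁ y∈⁅x⁆    = there y∈⁅x⁆
    ...   | inj₂ y∈thirds = ⊥-elim (x∈∁p⇒x∉p y∉thirds y∈thirds)

proposition6p4 : (r : ℕ) → 5 ≤ r →
    -- γ(C_r) = ⌈ r/3 ⌉
    IsMinCard (Dominating (cycle r)) ⌈ r /3⌉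
    -- ZIR(W_{r+1}) = r - γ(C_r)
    × IsMaxCard (MaximalZIrSet (wheel r)) (r ∸ ⌈ r /3⌉)
    -- zir(W_{r+1}) = 3
    × IsMinCard (MaximalZIrSet (wheel r)) 3
    -- Z(W_{r+1}) = 3
    × IsMinCard (ZeroForcingSet (wheel r)) 3
    -- Zbar(W_{r+1}) = 3
    × IsMaxCard (MinimalZeroForcingSet (wheel r)) 3
proposition6p4 (suc m) 5≤r@(s≤s 4≤m) =
    ((thirds (suc m) , thirds-dominating , ∣thirds∣≡⌈n/3⌉ (suc m)) , λ _ → dominating⇒⌈r/3⌉≤∣D∣)
  , ((coThirds , coThirds-maximal , ∣coThirds∣) , λ S → ZIr⇒∣S∣≤r∸⌈r/3⌉ 5≤r S ∘ proj₁)
  , ((hubEdge , hubEdge-maximal , ∣hubEdge∣≡3) , maximalZIr⇒3≤∣S∣)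
  , ((hubEdge , hubEdge-forces , ∣hubEdge∣≡3) , forces⇒3≤∣B∣)
  , ((hubEdge , hubEdge-minimal , ∣hubEdge∣≡3) , minimalForcing⇒∣B∣≤3)
  where
  open Cycle m
  open Wheel (≤-trans (s≤s (s≤s z≤n)) 4≤m)
  coThirds-maximal : MaximalZIrSet W coThirds
  coThirds-maximal = coThirds-ZIr , maximum⇒maximal (ZIr⇒∣S∣≤r∸⌈r/3⌉ 5≤r) ∣coThirds∣
  hubEdge-maximal : MaximalZIrSet W hubEdge
  hubEdge-maximal = hubEdge-ZIr , hubEdge⊂⇒¬ZIr
  hubEdge-minimal : MinimalZeroForcingSet W hubEdge
  hubEdge-minimal = hubEdge-forces , minimum⇒minimal forces⇒3≤∣B∣ ∣hubEdge∣≡3
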